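{- For every $\nu\ge1$, $m\ge0$ and $j\ge1$, the word $T_\rho(\nu,m,j)$ is a palindrome, and, if $\nu$ divides $m$, the word $T_\tau(\nu,m,j)$ is a palindrome.
   Context: Alphabet $\Sigma=\mathbb{N}$; words are finite sequences over $\Sigma$, $|w|$ is length, $w^R$ the reverse. An equivalence map is a morphism of $\Sigma^*$ induced by a bijection $\Sigma\to\Sigma$; $x\sim y$ means $f(x)=y$ for some equivalence map $f$. A double occurrence word (DOW) is a word in which every symbol occurs zero or exactly two times; a DOW $w$ is a palindrome if $w\sim w^R$. A word is in ascending order if it is empty or its first symbol is $1$ and the first occurrence of each symbol is one greater than the largest symbol preceding it. Insertions: for a DOW $w$ in ascending order with largest symbol $M$ ($M=0$ if $w$ is empty), $\nu\ge1$, $u=(M+1)\cdots(M+\nu)$ and $1\le k\le\ell\le|w|+1$, write $w=y_1y_2y_3$ with $|y_1|=k-1$, $|y_1y_2|=\ell-1$; $w\star\rho(\nu,k,\ell)=y_1uy_2uy_3$ and $w\star\tau(\nu,k,\ell)=y_1uy_2u^Ry_3$. For $h,\nu\ge1$ let $x_i=((i-1)\nu+1)\cdots(i\nu)$; $\mathrm{Int}(h,\nu)=x_1\cdots x_hx_1^R\cdots x_h^R$. Tangled cords: for $m\ge0$, $\nu,j\ge1$, let $s_0=12\cdots m12\cdots m$ ($\epsilon$ if $m=0$), $s_j=s_{j-1}\star\rho(\nu,|s_{j-1}|-m+1,|s_{j-1}|+1)$, $T_\rho(\nu,m,j)=s_j$. If $\nu\mid m$, let $t_0=\mathrm{Int}(m/\nu,\nu)$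 ($\epsilon$ if $m=0$), $t_j=t_{j-1}\star\tau(\nu,|t_{j-1}|-m+1,|t_{j-1}|+1)$, $T_\tau(\nu,m,j)=t_j$. -}

module Defs where

open import Data.Nat using (ℕ; zero; suc; _+_; _*_; _∸_; _⊔_)
open import Data.List using (List; []; _∷_; _++_; map; reverse; length; take; drop; foldr; concat; applyUpTo)
open import Data.List.Relation.Unary.All using (All)
open import Data.Product using (Σ; _×_)
open import Function.Bundles using (_⤖_; Bijection)
open import Relation.Binary.PropositionalEquality using (_≡_)
open import Relation.Nullary using (¬_; yes; no)
open import Data.Sum using (_⊎_)
open import Data.Nat using (_≟_)
open import Data.List.Membership.Propositional using (_∈_)

Word : Set
Word = List ℕ

_∼_ : Word → Word → Set
x ∼ y = Σ (ℕ ⤖ ℕ) (λ f → map (Bijection.to f) x ≡ y)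

occ : ℕ → Word → ℕ
occ a [] = 0
occ a (b ∷ w) with a ≟ b
... | yes _ = suc (occ a w)
... | no _ = occ a w

IsDOW : Word → Set
IsDOW w = (a : ℕ) → (occ a w ≡ 0) ⊎ (occ a w ≡ 2)

IsPalindrome : Word → Set
IsPalindrome w = IsDOW w × (w ∼ reverse w)

maxSym : Word → ℕ
maxSym = foldr _⊔_ 0

block : ℕ → ℕ → Word
block a ν = applyUpTo (λ i → a + suc i) ν

-- w ⋆ ρ(ν,k,ℓ) and w ⋆ τ(ν,k,ℓ), with w = y₁ y₂ y₃, |y₁| = k-1, |y₁y₂| = ℓ-1
insρ : ℕ → ℕ → ℕ → Word → Word
insρ ν k ℓ w =
  let u = block (maxSym w) ν in
  take (k ∸ 1) w ++ u ++ drop (k ∸ 1) (take (ℓ ∸ 1) w) ++ u ++ drop (ℓ ∸ 1) w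

insτ : ℕ → ℕ → ℕ → Word → Word
insτ ν k ℓ w =
  let u = block (maxSym w) ν in
  take (k ∸ 1) w ++ u ++ drop (k ∸ 1) (take (ℓ ∸ 1) w) ++ reverse u ++ drop (ℓ ∸ 1) w

-- Int(h,ν) = x₁⋯x_h x₁^R⋯x_h^R with x_i = ((i-1)ν+1)⋯(iν)
xblk : ℕ → ℕ → Word   -- xblk ν i = x_{i+1}
xblk ν i = block (i * ν) ν

Int : ℕ → ℕ → Word
Int h ν = concat (applyUpTo (xblk ν) h) ++ concat (applyUpTo (λ i → reverse (xblk ν i)) h)

sρ : ℕ → ℕ → ℕ → Word
sρ ν m zero = block 0 m ++ block 0 m
sρ ν m (suc j) = let s = sρ ν m j in insρ ν (length s ∸ m + 1) (length s + 1) s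

Tρ : ℕ → ℕ → ℕ → Word
Tρ = sρ

-- t₀ = Int(m/ν, ν); the caller supplies h with m = h * ν (ε when m = 0)
tτ : ℕ → ℕ → ℕ → ℕ → Word
tτ ν h m zero = Int h ν
tτ ν h m (suc j) = let t = tτ ν h m j in insτ ν (length t ∸ m + 1) (length t + 1) t

-- Both iterations have a closed form X · p₀ ⋯ p_{j-1} · Y_j: the i-th insertion contributes the
-- fresh block u_i = (m+iν+1)⋯(m+iν+ν) as the first half of the pair p_i, while the tail Y_j of
-- length m shifts along.  For T_ρ, X = 1⋯m, p_i = u_i · (iν+1)⋯(iν+ν) and Y_j = (jν+1)⋯(jν+m);
-- for T_τ (m = hν, blocks x_i as in Int), X = x_1⋯x_h, p_i = x_{h+i+1} x_{i+1}^R and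
-- Y_j = x_{j+1}^R ⋯ x_{j+h}^R.  Such a word uses each of 1, …, m+jν exactly twice, and its reverse
-- is its image under an involution of the alphabet: a ↦ m+jν+1-a for T_ρ, and for T_τ the map
-- reversing the order of the blocks x_1, …, x_{h+j} while keeping the order inside each block.
-- The argument works for every j (also j = 0) and, for T_ρ, for every ν.

module Submission where

open import Data.List using ([]; _∷_; _++_; [_]; map; reverse; length; take; drop; concat; applyUpTo)
open import Data.List.Membership.Propositional using (_∈_)
open import Data.List.Properties
  using (++-assoc; ++-identityʳ; map-++; reverse-++; reverse-involutive; reverse-map; unfold-reverse;
         length-++; length-reverse; take-all; drop-all; applyUpTo-∷ʳ; concat-++)
open import Data.List.Relation.Binary.Subset.Propositional using (_⊆_)
open import Data.List.Relation.Unary.Any using (here; there)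
open import Data.Nat using (ℕ; zero; suc; _+_; _*_; _∸_; _⊔_; _≤_; _<_; _≥_; z≤n; s≤s; _≟_; _<?_; NonZero)
open import Data.Nat.Divisibility using (n∣m*n)
open import Data.Nat.DivMod
  using (_%_; _/_; m≡m%n+[m/n]*n; [m+kn]%n≡m%n; m<n⇒m%n≡m; +-distrib-/-∣ʳ; m<n⇒m/n≡0; m*n/n≡m; m%n<n; m<n*o⇒m/o<n)
open import Data.Nat.Properties
open import Algebra.Properties.CommutativeSemigroup +-commutativeSemigroup
  using () renaming (interchange to +-interchange)
open import Data.Nat.Tactic.RingSolver using (solve-∀)
open import Data.Product using (_×_; _,_)
open import Data.Sum using (_⊎_; inj₁; inj₂)
open import Function.Bundles using (mk↔ₛ′)
open import Function.Properties.Inverse using (↔⇒⤖)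
open import Relation.Binary.PropositionalEquality hiding ([_])
open import Relation.Nullary using (yes; no; contradiction)

open import Defs

block′ : ℕ → ℕ → Word
block′ b zero    = []
block′ b (suc n) = suc b ∷ block′ (suc b) n

applyUpTo≡block′ : ∀ (f : ℕ → ℕ) b n → (∀ i → f i ≡ b + suc i) → applyUpTo f n ≡ block′ b n
applyUpTo≡block′ f b zero    f≗ = refl
applyUpTo≡block′ f b (suc n) f≗ =
  cong₂ _∷_ (trans (f≗ 0) (+-comm b 1))
            (applyUpTo≡block′ (λ i → f (suc i)) (suc b) n (λ i → trans (f≗ (suc i)) (+-suc b (suc i))))

block≡block′ : ∀ b n → block b n ≡ block′ b n
block≡block′ b n = applyUpTo≡block′ _ b n (λ _ → refl)

block′-++ : ∀ b n p → block′ b (n + p) ≡ block′ b n ++ block′ (b + n) p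
block′-++ b zero    p = cong (λ c → block′ c p) (sym (+-identityʳ b))
block′-++ b (suc n) p = cong (suc b ∷_) (trans (block′-++ (suc b) n p)
                                               (cong (λ c → block′ (suc b) n ++ block′ c p) (sym (+-suc b n))))

length-block′ : ∀ b n → length (block′ b n) ≡ n
length-block′ b zero    = refl
length-block′ b (suc n) = cong suc (length-block′ (suc b) n)

reverse-block′-suc : ∀ c n → reverse (block′ c (suc n)) ≡ suc (c + n) ∷ reverse (block′ c n)
reverse-block′-suc c n = begin
  reverse (block′ c (suc n))               ≡⟨ cong (λ k → reverse (block′ c k)) (+-comm 1 n) ⟩
  reverse (block′ c (n + 1))               ≡⟨ cong reverse (block′-++ c n 1) ⟩
  reverse (block′ c n ++ [ suc (c + n) ])  ≡⟨ reverse-++ (block′ c n) [ suc (c + n) ] ⟩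
  suc (c + n) ∷ reverse (block′ c n)       ∎
  where open ≡-Reasoning

occ-++ : ∀ a x y → occ a (x ++ y) ≡ occ a x + occ a y
occ-++ a []      y = refl
occ-++ a (b ∷ x) y with a ≟ b
... | yes _ = cong suc (occ-++ a x y)
... | no  _ = occ-++ a x y

occ-reverse : ∀ a x → occ a (reverse x) ≡ occ a x
occ-reverse a []      = refl
occ-reverse a (b ∷ x) = begin
  occ a (reverse (b ∷ x))         ≡⟨ cong (occ a) (unfold-reverse b x) ⟩
  occ a (reverse x ++ [ b ])      ≡⟨ occ-++ a (reverse x) [ b ] ⟩
  occ a (reverse x) + occ a [ b ] ≡⟨ cong (_+ occ a [ b ]) (occ-reverse a x) ⟩
  occ a x + occ a [ b ]           ≡⟨ +-comm (occ a x) _ ⟩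
  occ a [ b ] + occ a x           ≡⟨ occ-++ a [ b ] x ⟨
  occ a (b ∷ x)                   ∎
  where open ≡-Reasoning

∈⇒occ≢0 : ∀ {a w} → a ∈ w → occ a w ≢ 0
∈⇒occ≢0 {a} {b ∷ w} a∈w with a ≟ b | a∈w
... | yes _   | _          = λ ()
... | no  a≢b | here a≡b   = contradiction a≡b a≢b
... | no  _   | there a∈w′ = ∈⇒occ≢0 a∈w′

occ≢0⇒∈ : ∀ {a} w → occ a w ≢ 0 → a ∈ w
occ≢0⇒∈ []          occ≢0 = contradiction refl occ≢0
occ≢0⇒∈ {a} (b ∷ w) occ≢0 with a ≟ b
... | yes a≡b = here a≡b
... | no  _   = there (occ≢0⇒∈ w occ≢0)

occ-block′-below : ∀ {a b} n → a ≤ b → occ a (block′ b n) ≡ 0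
occ-block′-below {a} {b} zero    a≤b = refl
occ-block′-below {a} {b} (suc n) a≤b with a ≟ suc b
... | yes refl = contradiction a≤b (1+n≰n)
... | no  _    = occ-block′-below n (m≤n⇒m≤1+n a≤b)

occ-block′ : ∀ a b n → occ a (block′ b n) ≡ 0 ⊎ occ a (block′ b n) ≡ 1
occ-block′ a b zero    = inj₁ refl
occ-block′ a b (suc n) with a ≟ suc b
... | yes refl = inj₂ (cong suc (occ-block′-below n ≤-refl))
... | no  _    = occ-block′ a (suc b) n

record IsDOWOn (N : ℕ) (w : Word) : Set where
  constructor occ-doubled
  field occ≡ : ∀ a → occ a w ≡ occ a (block′ 0 N) + occ a (block′ 0 N)

IsDOWOn⇒IsDOW : ∀ {N w} → IsDOWOn N w → IsDOW w
IsDOWOn⇒IsDOW {N} (occ-doubled w-occ) a with occ-block′ a 0 N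
... | inj₁ eq = inj₁ (trans (w-occ a) (cong₂ _+_ eq eq))
... | inj₂ eq = inj₂ (trans (w-occ a) (cong₂ _+_ eq eq))

∈⇒≤maxSym : ∀ {a w} → a ∈ w → a ≤ maxSym w
∈⇒≤maxSym {w = b ∷ w} (here refl)  = m≤m⊔n b (maxSym w)
∈⇒≤maxSym {w = b ∷ w} (there a∈w) = ≤-trans (∈⇒≤maxSym a∈w) (m≤n⊔m b (maxSym w))

maxSym-mono-⊆ : ∀ {v w} → v ⊆ w → maxSym v ≤ maxSym w
maxSym-mono-⊆ {[]}    v⊆w = z≤n
maxSym-mono-⊆ {a ∷ v} v⊆w = ⊔-lub (∈⇒≤maxSym (v⊆w (here refl))) (maxSym-mono-⊆ (λ a∈v → v⊆w (there a∈v)))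

maxSym-block′-suc : ∀ b n → maxSym (block′ b (suc n)) ≡ suc (b + n)
maxSym-block′-suc b zero    = trans (⊔-identityʳ (suc b)) (cong suc (sym (+-identityʳ b)))
maxSym-block′-suc b (suc n) = begin
  suc b ⊔ maxSym (block′ (suc b) (suc n)) ≡⟨ cong (suc b ⊔_) (maxSym-block′-suc (suc b) n) ⟩
  suc b ⊔ suc (suc (b + n))               ≡⟨ m≤n⇒m⊔n≡n (s≤s (m≤n⇒m≤1+n (m≤m+n b n))) ⟩
  suc (suc (b + n))                       ≡⟨ cong suc (+-suc b n) ⟨
  suc (b + suc n)                         ∎
  where open ≡-Reasoning

maxSym-block′ : ∀ n → maxSym (block′ 0 n) ≡ n
maxSym-block′ zero    = refl
maxSym-block′ (suc n) = maxSym-block′-suc 0 n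

IsDOWOn⇒maxSym : ∀ {N w} → IsDOWOn N w → maxSym w ≡ N
IsDOWOn⇒maxSym {N} {w} (occ-doubled w-occ) =
  trans (≤-antisym (maxSym-mono-⊆ w⊆B) (maxSym-mono-⊆ B⊆w)) (maxSym-block′ N)
  where
  B = block′ 0 N
  w⊆B : w ⊆ B
  w⊆B {a} a∈w = occ≢0⇒∈ B (λ occB≡0 → ∈⇒occ≢0 a∈w (trans (w-occ a) (cong₂ _+_ occB≡0 occB≡0)))
  B⊆w : B ⊆ w
  B⊆w {a} a∈B = occ≢0⇒∈ w (λ occw≡0 → ∈⇒occ≢0 a∈B (m+n≡0⇒m≡0 _ (trans (sym (w-occ a)) occw≡0)))

concatUpTo : ℕ → (ℕ → Word) → Word
concatUpTo zero    g = []
concatUpTo (suc n) g = concatUpTo n g ++ g n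

concat-applyUpTo : ∀ (g : ℕ → Word) n → concat (applyUpTo g n) ≡ concatUpTo n g
concat-applyUpTo g zero    = refl
concat-applyUpTo g (suc n) = begin
  concat (applyUpTo g (suc n))          ≡⟨ cong concat (applyUpTo-∷ʳ g n) ⟨
  concat (applyUpTo g n ++ [ g n ])     ≡⟨ concat-++ (applyUpTo g n) [ g n ] ⟨
  concat (applyUpTo g n) ++ (g n ++ []) ≡⟨ cong₂ _++_ (concat-applyUpTo g n) (++-identityʳ (g n)) ⟩
  concatUpTo n g ++ g n                 ∎
  where open ≡-Reasoning

concatUpTo-suc : ∀ n (g : ℕ → Word) → concatUpTo (suc n) g ≡ g 0 ++ concatUpTo n (λ i → g (suc i))
concatUpTo-suc zero    g = sym (++-identityʳ (g 0))
concatUpTo-suc (suc n) g = trans (cong (_++ g (suc n)) (concatUpTo-suc n g)) (++-assoc (g 0) _ _)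

concatUpTo-cong : ∀ n {g h : ℕ → Word} → (∀ i → g i ≡ h i) → concatUpTo n g ≡ concatUpTo n h
concatUpTo-cong zero    g≗h = refl
concatUpTo-cong (suc n) g≗h = cong₂ _++_ (concatUpTo-cong n g≗h) (g≗h n)

concatUpTo-block′ : ∀ c ν n → concatUpTo n (λ i → block′ (c + i * ν) ν) ≡ block′ c (n * ν)
concatUpTo-block′ c ν zero    = refl
concatUpTo-block′ c ν (suc n) = begin
  concatUpTo n (λ i → block′ (c + i * ν) ν) ++ block′ (c + n * ν) ν
    ≡⟨ cong (_++ block′ (c + n * ν) ν) (concatUpTo-block′ c ν n) ⟩
  block′ c (n * ν) ++ block′ (c + n * ν) ν ≡⟨ block′-++ c (n * ν) ν ⟨
  block′ c (n * ν + ν)                     ≡⟨ cong (block′ c) (+-comm (n * ν) ν) ⟩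
  block′ c (ν + n * ν)                     ∎
  where open ≡-Reasoning

length-concatUpTo : ∀ {ν} n (g : ℕ → Word) → (∀ i → length (g i) ≡ ν) → length (concatUpTo n g) ≡ n * ν
length-concatUpTo {ν} zero    g |g|≡ν = refl
length-concatUpTo {ν} (suc n) g |g|≡ν =
  trans (length-++ (concatUpTo n g))
        (trans (cong₂ _+_ (length-concatUpTo n g |g|≡ν) (|g|≡ν n)) (+-comm (n * ν) ν))

occ-concatUpTo-cong : ∀ a n {g h : ℕ → Word} → (∀ i → occ a (g i) ≡ occ a (h i)) →
  occ a (concatUpTo n g) ≡ occ a (concatUpTo n h)
occ-concatUpTo-cong a zero    g≈h = refl
occ-concatUpTo-cong a (suc n) {g} {h} g≈h = begin
  occ a (concatUpTo n g ++ g n)         ≡⟨ occ-++ a (concatUpTo n g) (g n) ⟩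
  occ a (concatUpTo n g) + occ a (g n)  ≡⟨ cong₂ _+_ (occ-concatUpTo-cong a n g≈h) (g≈h n) ⟩
  occ a (concatUpTo n h) + occ a (h n)  ≡⟨ occ-++ a (concatUpTo n h) (h n) ⟨
  occ a (concatUpTo n h ++ h n)         ∎
  where open ≡-Reasoning

occ-concatUpTo-++ : ∀ a n (g h : ℕ → Word) →
  occ a (concatUpTo n (λ i → g i ++ h i)) ≡ occ a (concatUpTo n g) + occ a (concatUpTo n h)
occ-concatUpTo-++ a zero    g h = refl
occ-concatUpTo-++ a (suc n) g h = begin
  occ a (concatUpTo n gh ++ (g n ++ h n))
    ≡⟨ occ-++ a (concatUpTo n gh) _ ⟩
  occ a (concatUpTo n gh) + occ a (g n ++ h n)
    ≡⟨ cong₂ _+_ (occ-concatUpTo-++ a n g h) (occ-++ a (g n) (h n)) ⟩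
  (occ a (concatUpTo n g) + occ a (concatUpTo n h)) + (occ a (g n) + occ a (h n))
    ≡⟨ +-interchange (occ a (concatUpTo n g)) _ _ _ ⟩
  (occ a (concatUpTo n g) + occ a (g n)) + (occ a (concatUpTo n h) + occ a (h n))
    ≡⟨ cong₂ _+_ (occ-++ a (concatUpTo n g) (g n)) (occ-++ a (concatUpTo n h) (h n)) ⟨
  occ a (concatUpTo n g ++ g n) + occ a (concatUpTo n h ++ h n) ∎
  where
  open ≡-Reasoning
  gh = λ i → g i ++ h i

occ-sandwich : ∀ a (X : Word) n (g h : ℕ → Word) (Y : Word) →
  occ a (X ++ concatUpTo n (λ i → g i ++ h i) ++ Y) ≡ occ a (X ++ concatUpTo n g) + occ a (concatUpTo n h ++ Y)
occ-sandwich a X n g h Y = begin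
  occ a (X ++ concatUpTo n (λ i → g i ++ h i) ++ Y)   ≡⟨ occ-++ a X _ ⟩
  occ a X + occ a (concatUpTo n (λ i → g i ++ h i) ++ Y)
    ≡⟨ cong (occ a X +_) (occ-++ a (concatUpTo n (λ i → g i ++ h i)) Y) ⟩
  occ a X + (occ a (concatUpTo n (λ i → g i ++ h i)) + occ a Y)
    ≡⟨ cong (λ d → occ a X + (d + occ a Y)) (occ-concatUpTo-++ a n g h) ⟩
  occ a X + ((occ a G + occ a H) + occ a Y)          ≡⟨ regroup (occ a X) (occ a G) (occ a H) (occ a Y) ⟩
  (occ a X + occ a G) + (occ a H + occ a Y)          ≡⟨ cong₂ _+_ (occ-++ a X G) (occ-++ a H Y) ⟨
  occ a (X ++ G) + occ a (H ++ Y)                    ∎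
  where
  open ≡-Reasoning
  G = concatUpTo n g
  H = concatUpTo n h
  regroup : ∀ x g h y → x + ((g + h) + y) ≡ (x + g) + (h + y)
  regroup = solve-∀

take-length-++ : ∀ (x y : Word) → take (length x) (x ++ y) ≡ x
take-length-++ []      y = refl
take-length-++ (a ∷ x) y = cong (a ∷_) (take-length-++ x y)

drop-length-++ : ∀ (x y : Word) → drop (length x) (x ++ y) ≡ y
drop-length-++ []      y = refl
drop-length-++ (a ∷ x) y = drop-length-++ x y

splice : Word → Word → ℕ → ℕ → Word → Word
splice u u′ k ℓ w = take (k ∸ 1) w ++ u ++ drop (k ∸ 1) (take (ℓ ∸ 1) w) ++ u′ ++ drop (ℓ ∸ 1) w

splice-end : ∀ (u u′ P L : Word) {m} → length L ≡ m →
  splice u u′ (length (P ++ L) ∸ m + 1) (length (P ++ L) + 1) (P ++ L) ≡ P ++ u ++ L ++ u′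
splice-end u u′ P L {m} |L|≡m = begin
  take (n ∸ m + 1 ∸ 1) w ++ u ++ drop (n ∸ m + 1 ∸ 1) (take (n + 1 ∸ 1) w) ++ u′ ++ drop (n + 1 ∸ 1) w
    ≡⟨ cong₂ (λ k ℓ → take k w ++ u ++ drop k (take ℓ w) ++ u′ ++ drop ℓ w) k≡|P| (m+n∸n≡m n 1) ⟩
  take (length P) w ++ u ++ drop (length P) (take n w) ++ u′ ++ drop n w
    ≡⟨ cong₂ (λ x z → take (length P) w ++ u ++ drop (length P) x ++ u′ ++ z)
             (take-all n w ≤-refl) (drop-all n w ≤-refl) ⟩
  take (length P) w ++ u ++ drop (length P) w ++ u′ ++ []
    ≡⟨ cong₂ (λ x y → x ++ u ++ y ++ u′ ++ []) (take-length-++ P L) (drop-length-++ P L) ⟩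
  P ++ u ++ L ++ u′ ++ []
    ≡⟨ cong (λ z → P ++ u ++ L ++ z) (++-identityʳ u′) ⟩
  P ++ u ++ L ++ u′ ∎
  where
  open ≡-Reasoning
  w = P ++ L
  n = length w
  k≡|P| : n ∸ m + 1 ∸ 1 ≡ length P
  k≡|P| = begin
    n ∸ m + 1 ∸ 1               ≡⟨ m+n∸n≡m (n ∸ m) 1 ⟩
    n ∸ m                       ≡⟨ cong (_∸ m) (trans (length-++ P) (cong (length P +_) |L|≡m)) ⟩
    length P + m ∸ m            ≡⟨ m+n∸n≡m (length P) m ⟩
    length P                    ∎

splice-sandwich : ∀ (second : Word → Word) (X : Word) (p Y : ℕ → Word) j {m u v} →
  length (Y j) ≡ m → p j ≡ u ++ v → Y j ++ second u ≡ v ++ Y (suc j) →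
  let C = λ k → X ++ concatUpTo k p ++ Y k in
  splice u (second u) (length (C j) ∸ m + 1) (length (C j) + 1) (C j) ≡ C (suc j)
splice-sandwich second X p Y j {m} {u} {v} |Y|≡m p≡uv shift = begin
  splice u (second u) (length (X ++ D ++ Y j) ∸ m + 1) (length (X ++ D ++ Y j) + 1) (X ++ D ++ Y j)
    ≡⟨ cong (λ w → splice u (second u) (length w ∸ m + 1) (length w + 1) w) (++-assoc X D (Y j)) ⟨
  splice u (second u) (length ((X ++ D) ++ Y j) ∸ m + 1) (length ((X ++ D) ++ Y j) + 1) ((X ++ D) ++ Y j)
    ≡⟨ splice-end u (second u) (X ++ D) (Y j) |Y|≡m ⟩
  (X ++ D) ++ u ++ Y j ++ second u   ≡⟨ cong (λ z → (X ++ D) ++ u ++ z) shift ⟩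
  (X ++ D) ++ u ++ v ++ Y (suc j)    ≡⟨ cong ((X ++ D) ++_) (++-assoc u v (Y (suc j))) ⟨
  (X ++ D) ++ (u ++ v) ++ Y (suc j)  ≡⟨ cong (λ z → (X ++ D) ++ z ++ Y (suc j)) p≡uv ⟨
  (X ++ D) ++ p j ++ Y (suc j)       ≡⟨ ++-assoc X D (p j ++ Y (suc j)) ⟩
  X ++ D ++ p j ++ Y (suc j)         ≡⟨ cong (X ++_) (++-assoc D (p j) (Y (suc j))) ⟨
  X ++ (D ++ p j) ++ Y (suc j)       ∎
  where
  open ≡-Reasoning
  D = concatUpTo j p

map-concatUpTo-reverse : ∀ (f : ℕ → ℕ) n (g h : ℕ → Word) →
  (∀ i i′ → suc (i + i′) ≡ n → map f (g i) ≡ reverse (h i′)) →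
  map f (concatUpTo n g) ≡ reverse (concatUpTo n h)
map-concatUpTo-reverse f zero    g h g↦h = refl
map-concatUpTo-reverse f (suc n) g h g↦h = begin
  map f (concatUpTo n g ++ g n)                        ≡⟨ map-++ f (concatUpTo n g) (g n) ⟩
  map f (concatUpTo n g) ++ map f (g n)                ≡⟨ cong₂ _++_ init last ⟩
  reverse (concatUpTo n h′) ++ reverse (h 0)           ≡⟨ reverse-++ (h 0) (concatUpTo n h′) ⟨
  reverse (h 0 ++ concatUpTo n h′)                     ≡⟨ cong reverse (concatUpTo-suc n h) ⟨
  reverse (concatUpTo (suc n) h)                       ∎
  where
  open ≡-Reasoning
  h′ = λ i → h (suc i)
  init : map f (concatUpTo n g) ≡ reverse (concatUpTo n h′)
  init = map-concatUpTo-reverse f n g h′ (λ i i′ eq → g↦h i (suc i′) (cong suc (trans (+-suc i i′) eq)))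
  last : map f (g n) ≡ reverse (h 0)
  last = g↦h n 0 (cong suc (+-identityʳ n))

map-++-reverse : ∀ (f : ℕ → ℕ) (X Y Z : Word) →
  map f X ≡ reverse Z → map f Y ≡ reverse Y → map f Z ≡ reverse X →
  map f (X ++ Y ++ Z) ≡ reverse (X ++ Y ++ Z)
map-++-reverse f X Y Z X↦Z Y↦Y Z↦X = begin
  map f (X ++ Y ++ Z)                   ≡⟨ map-++ f X (Y ++ Z) ⟩
  map f X ++ map f (Y ++ Z)             ≡⟨ cong (map f X ++_) (map-++ f Y Z) ⟩
  map f X ++ map f Y ++ map f Z         ≡⟨ cong₂ _++_ X↦Z (cong₂ _++_ Y↦Y Z↦X) ⟩
  reverse Z ++ reverse Y ++ reverse X   ≡⟨ ++-assoc (reverse Z) (reverse Y) (reverse X) ⟨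
  (reverse Z ++ reverse Y) ++ reverse X ≡⟨ cong (_++ reverse X) (reverse-++ Y Z) ⟨
  reverse (Y ++ Z) ++ reverse X         ≡⟨ reverse-++ X (Y ++ Z) ⟨
  reverse (X ++ Y ++ Z)                 ∎
  where open ≡-Reasoning

involution-reverses⇒∼ : ∀ (f : ℕ → ℕ) {w} → (∀ i → f (f i) ≡ i) → map f w ≡ reverse w → w ∼ reverse w
involution-reverses⇒∼ f f∘f≡id f-reverses = ↔⇒⤖ (mk↔ₛ′ f f f∘f≡id f∘f≡id) , f-reverses

mirror : ℕ → ℕ → ℕ
mirror N zero    = zero
mirror N (suc p) with p <? N
... | yes _ = N ∸ p
... | no  _ = suc p

mirror-inside : ∀ {N} b c → suc (b + c) ≡ N → mirror N (suc b) ≡ suc c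
mirror-inside b c refl with b <? suc (b + c)
... | yes _   = trans (+-∸-assoc 1 (m≤m+n b c)) (cong suc (m+n∸m≡n b c))
... | no  b≮N = contradiction (s≤s (m≤m+n b c)) b≮N

mirror-outside : ∀ {N p} → N ≤ p → mirror N (suc p) ≡ suc p
mirror-outside {N} {p} N≤p with p <? N
... | yes p<N = contradiction N≤p (<⇒≱ p<N)
... | no  _   = refl

mirror-involutive : ∀ N i → mirror N (mirror N i) ≡ i
mirror-involutive N zero    = refl
mirror-involutive N (suc p) with <-≤-connex p N
... | inj₂ N≤p = trans (cong (mirror N) (mirror-outside N≤p)) (mirror-outside N≤p)
... | inj₁ p<N with m≤n⇒∃[o]m+o≡n p<N
...   | c , eq =
  trans (cong (mirror N) (mirror-inside p c eq)) (mirror-inside c p (trans (cong suc (+-comm c p)) eq))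

map-mirror-block′ : ∀ {N} b n c → b + n + c ≡ N → map (mirror N) (block′ b n) ≡ reverse (block′ c n)
map-mirror-block′ b zero    c eq = refl
map-mirror-block′ {N} b (suc n) c eq = begin
  mirror N (suc b) ∷ map (mirror N) (block′ (suc b) n)
    ≡⟨ cong₂ _∷_ (mirror-inside b (c + n) (trans (head-position b n c) eq))
                 (map-mirror-block′ (suc b) n c (trans (tail-position b n c) eq)) ⟩
  suc (c + n) ∷ reverse (block′ c n) ≡⟨ reverse-block′-suc c n ⟨
  reverse (block′ c (suc n))         ∎
  where
  open ≡-Reasoning
  head-position : ∀ b n c → suc (b + (c + n)) ≡ b + suc n + c
  head-position = solve-∀
  tail-position : ∀ b n c → suc b + n + c ≡ b + suc n + c
  tail-position = solve-∀

module _ (ν : ℕ) .{{_ : NonZero ν}} where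

  blockMirror : ℕ → ℕ → ℕ
  blockMirror K zero    = zero
  blockMirror K (suc p) with p <? K * ν
  ... | yes _ = suc (p % ν + (K ∸ suc (p / ν)) * ν)
  ... | no  _ = suc p

  blockMirror-inside : ∀ {K} r b c → r < ν → suc (b + c) ≡ K →
    blockMirror K (suc (r + b * ν)) ≡ suc (r + c * ν)
  blockMirror-inside {K} r b c r<ν refl with r + b * ν <? K * ν
  ... | no  p≮Kν =
    contradiction (≤-trans (+-monoˡ-≤ (b * ν) r<ν) (*-monoˡ-≤ ν (s≤s (m≤m+n b c)))) p≮Kν
  ... | yes _    = trans (cong₂ (λ r′ b′ → suc (r′ + (K ∸ suc b′) * ν)) rem quot)
                         (cong (λ c′ → suc (r + c′ * ν)) (m+n∸m≡n (suc b) c))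
    where
    rem : (r + b * ν) % ν ≡ r
    rem = trans ([m+kn]%n≡m%n r b ν) (m<n⇒m%n≡m r<ν)
    quot : (r + b * ν) / ν ≡ b
    quot = trans (+-distrib-/-∣ʳ r (n∣m*n b)) (cong₂ _+_ (m<n⇒m/n≡0 r<ν) (m*n/n≡m b ν))

  blockMirror-outside : ∀ K {p} → K * ν ≤ p → blockMirror K (suc p) ≡ suc p
  blockMirror-outside K {p} Kν≤p with p <? K * ν
  ... | yes p<Kν = contradiction Kν≤p (<⇒≱ p<Kν)
  ... | no  _    = refl

  blockMirror-involutive : ∀ K i → blockMirror K (blockMirror K i) ≡ i
  blockMirror-involutive K zero    = refl
  blockMirror-involutive K (suc p) with <-≤-connex p (K * ν)
  ... | inj₂ Kν≤p = trans (cong (blockMirror K) (blockMirror-outside K Kν≤p)) (blockMirror-outside K Kν≤p)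
  ... | inj₁ p<Kν with m≤n⇒∃[o]m+o≡n (m<n*o⇒m/o<n p<Kν)
  ...   | c , eq = begin
    blockMirror K (blockMirror K (suc p))           ≡⟨ cong (λ q → blockMirror K (blockMirror K (suc q))) p≡r+bν ⟩
    blockMirror K (blockMirror K (suc (r + b * ν))) ≡⟨ cong (blockMirror K) (blockMirror-inside r b c r<ν eq) ⟩
    blockMirror K (suc (r + c * ν))                 ≡⟨ blockMirror-inside r c b r<ν (trans (cong suc (+-comm c b)) eq) ⟩
    suc (r + b * ν)                                 ≡⟨ cong suc p≡r+bν ⟨
    suc p                                           ∎
    where
    open ≡-Reasoning
    r = p % ν
    b = p / ν
    r<ν : r < ν
    r<ν = m%n<n p ν
    p≡r+bν : p ≡ r + b * ν
    p≡r+bν = m≡m%n+[m/n]*n p ν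

  map-blockMirror-block′ : ∀ {K} b c → suc (b + c) ≡ K →
    map (blockMirror K) (block′ (b * ν) ν) ≡ block′ (c * ν) ν
  map-blockMirror-block′ {K} b c eq = shifted 0 ν ≤-refl
    where
    shifted : ∀ r n → r + n ≤ ν → map (blockMirror K) (block′ (r + b * ν) n) ≡ block′ (r + c * ν) n
    shifted r zero    r+n≤ν = refl
    shifted r (suc n) r+n≤ν = cong₂ _∷_ (blockMirror-inside r b c (≤-trans (s≤s (m≤m+n r n)) r+1+n≤ν) eq)
                                        (shifted (suc r) n r+1+n≤ν)
      where
      r+1+n≤ν : suc r + n ≤ ν
      r+1+n≤ν = ≤-trans (≤-reflexive (sym (+-suc r n))) r+n≤ν

module TangledCordRho (ν m : ℕ) where

  pairρ : ℕ → Word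
  pairρ i = block′ (m + i * ν) ν ++ block′ (i * ν) ν

  tailρ : ℕ → Word
  tailρ j = block′ (j * ν) m

  Cρ : ℕ → Word
  Cρ j = block′ 0 m ++ concatUpTo j pairρ ++ tailρ j

  Cρ-IsDOWOn : ∀ j → IsDOWOn (m + j * ν) (Cρ j)
  Cρ-IsDOWOn j = occ-doubled λ a → begin
    occ a (Cρ j)
      ≡⟨ occ-sandwich a (block′ 0 m) j (λ i → block′ (m + i * ν) ν) (λ i → block′ (i * ν) ν) (tailρ j) ⟩
    occ a (block′ 0 m ++ concatUpTo j (λ i → block′ (m + i * ν) ν))
      + occ a (concatUpTo j (λ i → block′ (i * ν) ν) ++ tailρ j)
      ≡⟨ cong₂ (λ x y → occ a (block′ 0 m ++ x) + occ a (y ++ tailρ j))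
               (concatUpTo-block′ m ν j) (concatUpTo-block′ 0 ν j) ⟩
    occ a (block′ 0 m ++ block′ m (j * ν)) + occ a (block′ 0 (j * ν) ++ block′ (j * ν) m)
      ≡⟨ cong₂ (λ x y → occ a x + occ a y) (block′-++ 0 m (j * ν)) (block′-++ 0 (j * ν) m) ⟨
    occ a (block′ 0 (m + j * ν)) + occ a (block′ 0 (j * ν + m))
      ≡⟨ cong (λ n → occ a (block′ 0 (m + j * ν)) + occ a (block′ 0 n)) (+-comm (j * ν) m) ⟩
    occ a (block′ 0 (m + j * ν)) + occ a (block′ 0 (m + j * ν)) ∎
    where open ≡-Reasoning

  sρ≡Cρ : ∀ j → sρ ν m j ≡ Cρ j
  sρ≡Cρ zero    = cong₂ _++_ (block≡block′ 0 m) (block≡block′ 0 m)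
  sρ≡Cρ (suc j) = begin
    insρ ν (length (sρ ν m j) ∸ m + 1) (length (sρ ν m j) + 1) (sρ ν m j)
      ≡⟨ cong (λ w → insρ ν (length w ∸ m + 1) (length w + 1) w) (sρ≡Cρ j) ⟩
    insρ ν (length (Cρ j) ∸ m + 1) (length (Cρ j) + 1) (Cρ j)
      ≡⟨ splice-sandwich (λ u → u) (block′ 0 m) pairρ tailρ j (length-block′ (j * ν) m)
           (cong (_++ block′ (j * ν) ν) (sym u≡)) (trans (cong (tailρ j ++_) u≡) shift) ⟩
    Cρ (suc j) ∎
    where
    open ≡-Reasoning
    u≡ : block (maxSym (Cρ j)) ν ≡ block′ (m + j * ν) ν
    u≡ = trans (block≡block′ _ ν) (cong (λ b → block′ b ν) (IsDOWOn⇒maxSym (Cρ-IsDOWOn j)))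
    shift : block′ (j * ν) m ++ block′ (m + j * ν) ν ≡ block′ (j * ν) ν ++ block′ (ν + j * ν) m
    shift = begin
      block′ (j * ν) m ++ block′ (m + j * ν) ν  ≡⟨ cong (λ b → block′ (j * ν) m ++ block′ b ν) (+-comm m (j * ν)) ⟩
      block′ (j * ν) m ++ block′ (j * ν + m) ν  ≡⟨ block′-++ (j * ν) m ν ⟨
      block′ (j * ν) (m + ν)                    ≡⟨ cong (block′ (j * ν)) (+-comm m ν) ⟩
      block′ (j * ν) (ν + m)                    ≡⟨ block′-++ (j * ν) ν m ⟩
      block′ (j * ν) ν ++ block′ (j * ν + ν) m  ≡⟨ cong (λ b → block′ (j * ν) ν ++ block′ b m) (+-comm (j * ν) ν) ⟩
      block′ (j * ν) ν ++ block′ (ν + j * ν) m  ∎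

  mirror-pairρ : ∀ i i′ → map (mirror (m + suc (i + i′) * ν)) (pairρ i) ≡ reverse (pairρ i′)
  mirror-pairρ i i′ = begin
    map f (block′ (m + i * ν) ν ++ block′ (i * ν) ν)
      ≡⟨ map-++ f (block′ (m + i * ν) ν) (block′ (i * ν) ν) ⟩
    map f (block′ (m + i * ν) ν) ++ map f (block′ (i * ν) ν)
      ≡⟨ cong₂ _++_ (map-mirror-block′ (m + i * ν) ν (i′ * ν) (outer m ν i i′))
                    (map-mirror-block′ (i * ν) ν (m + i′ * ν) (inner m ν i i′)) ⟩
    reverse (block′ (i′ * ν) ν) ++ reverse (block′ (m + i′ * ν) ν)
      ≡⟨ reverse-++ (block′ (m + i′ * ν) ν) (block′ (i′ * ν) ν) ⟨
    reverse (pairρ i′) ∎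
    where
    open ≡-Reasoning
    f = mirror (m + suc (i + i′) * ν)
    outer : ∀ m ν i i′ → m + i * ν + ν + i′ * ν ≡ m + suc (i + i′) * ν
    outer = solve-∀
    inner : ∀ m ν i i′ → i * ν + ν + (m + i′ * ν) ≡ m + suc (i + i′) * ν
    inner = solve-∀

  Cρ-reverses : ∀ j → map (mirror (m + j * ν)) (Cρ j) ≡ reverse (Cρ j)
  Cρ-reverses j = map-++-reverse (mirror (m + j * ν)) (block′ 0 m) (concatUpTo j pairρ) (tailρ j)
    (map-mirror-block′ 0 m (j * ν) refl)
    (map-concatUpTo-reverse (mirror (m + j * ν)) j pairρ pairρ
      (λ i i′ eq → subst (λ k → map (mirror (m + k * ν)) (pairρ i) ≡ reverse (pairρ i′)) eq
                         (mirror-pairρ i i′)))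
    (map-mirror-block′ (j * ν) m 0 (trans (+-identityʳ (j * ν + m)) (+-comm (j * ν) m)))

  Tρ-palindrome : ∀ j → IsPalindrome (Tρ ν m j)
  Tρ-palindrome j = subst IsPalindrome (sym (sρ≡Cρ j))
    (IsDOWOn⇒IsDOW (Cρ-IsDOWOn j) , involution-reverses⇒∼ (mirror N) (mirror-involutive N) (Cρ-reverses j))
    where N = m + j * ν

module TangledCordTau (ν : ℕ) .{{_ : NonZero ν}} (h : ℕ) where

  x : ℕ → Word
  x i = block′ (i * ν) ν

  pairτ : ℕ → Word
  pairτ i = x (h + i) ++ reverse (x i)

  tailτ : ℕ → Word
  tailτ j = concatUpTo h (λ i → reverse (x (j + i)))

  Cτ : ℕ → Word
  Cτ j = concatUpTo h x ++ concatUpTo j pairτ ++ tailτ j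

  concatUpTo-x : ∀ c n → concatUpTo c x ++ concatUpTo n (λ i → x (c + i)) ≡ block′ 0 (c * ν + n * ν)
  concatUpTo-x c n = begin
    concatUpTo c x ++ concatUpTo n (λ i → x (c + i))
      ≡⟨ cong₂ _++_ (concatUpTo-block′ 0 ν c) (trans (concatUpTo-cong n shift) (concatUpTo-block′ (c * ν) ν n)) ⟩
    block′ 0 (c * ν) ++ block′ (c * ν) (n * ν) ≡⟨ block′-++ 0 (c * ν) (n * ν) ⟨
    block′ 0 (c * ν + n * ν)                   ∎
    where
    open ≡-Reasoning
    shift : ∀ i → x (c + i) ≡ block′ (c * ν + i * ν) ν
    shift i = cong (λ b → block′ b ν) (*-distribʳ-+ ν c i)

  Cτ-IsDOWOn : ∀ j → IsDOWOn (h * ν + j * ν) (Cτ j)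
  Cτ-IsDOWOn j = occ-doubled λ a → begin
    occ a (Cτ j)
      ≡⟨ occ-sandwich a (concatUpTo h x) j (λ i → x (h + i)) (λ i → reverse (x i)) (tailτ j) ⟩
    occ a forward + occ a (concatUpTo j (λ i → reverse (x i)) ++ tailτ j)
      ≡⟨ cong (occ a forward +_) (occ-++ a (concatUpTo j (λ i → reverse (x i))) (tailτ j)) ⟩
    occ a forward + (occ a (concatUpTo j (λ i → reverse (x i))) + occ a (tailτ j))
      ≡⟨ cong (occ a forward +_) (cong₂ _+_ (occ-concatUpTo-cong a j (λ i → occ-reverse a (x i)))
                                          (occ-concatUpTo-cong a h (λ i → occ-reverse a (x (j + i))))) ⟩
    occ a forward + (occ a (concatUpTo j x) + occ a (concatUpTo h (λ i → x (j + i))))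
      ≡⟨ cong (occ a forward +_) (occ-++ a (concatUpTo j x) (concatUpTo h (λ i → x (j + i)))) ⟨
    occ a forward + occ a backward
      ≡⟨ cong₂ (λ y z → occ a y + occ a z) (concatUpTo-x h j) (concatUpTo-x j h) ⟩
    occ a (block′ 0 (h * ν + j * ν)) + occ a (block′ 0 (j * ν + h * ν))
      ≡⟨ cong (λ n → occ a (block′ 0 (h * ν + j * ν)) + occ a (block′ 0 n)) (+-comm (j * ν) (h * ν)) ⟩
    occ a (block′ 0 (h * ν + j * ν)) + occ a (block′ 0 (h * ν + j * ν)) ∎
    where
    open ≡-Reasoning
    forward = concatUpTo h x ++ concatUpTo j (λ i → x (h + i))
    backward = concatUpTo j x ++ concatUpTo h (λ i → x (j + i))

  tτ≡Cτ : ∀ j → tτ ν h (h * ν) j ≡ Cτ j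
  tτ≡Cτ zero    = cong₂ _++_
    (trans (concat-applyUpTo (xblk ν) h) (concatUpTo-cong h (λ i → block≡block′ (i * ν) ν)))
    (trans (concat-applyUpTo _ h) (concatUpTo-cong h (λ i → cong reverse (block≡block′ (i * ν) ν))))
  tτ≡Cτ (suc j) = begin
    insτ ν (length (tτ ν h m j) ∸ m + 1) (length (tτ ν h m j) + 1) (tτ ν h m j)
      ≡⟨ cong (λ w → insτ ν (length w ∸ m + 1) (length w + 1) w) (tτ≡Cτ j) ⟩
    insτ ν (length (Cτ j) ∸ m + 1) (length (Cτ j) + 1) (Cτ j)
      ≡⟨ splice-sandwich reverse (concatUpTo h x) pairτ tailτ j |tail|≡m
           (cong (_++ reverse (x j)) (sym u≡)) (trans (cong (λ u → tailτ j ++ reverse u) u≡) shift) ⟩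
    Cτ (suc j) ∎
    where
    open ≡-Reasoning
    m = h * ν
    u≡ : block (maxSym (Cτ j)) ν ≡ x (h + j)
    u≡ = trans (block≡block′ _ ν)
      (cong (λ b → block′ b ν) (trans (IsDOWOn⇒maxSym (Cτ-IsDOWOn j)) (sym (*-distribʳ-+ ν h j))))
    |tail|≡m : length (tailτ j) ≡ m
    |tail|≡m = length-concatUpTo h _ (λ i → trans (length-reverse (x (j + i))) (length-block′ _ ν))
    shift : tailτ j ++ reverse (x (h + j)) ≡ reverse (x j) ++ tailτ (suc j)
    shift = begin
      tailτ j ++ reverse (x (h + j))  ≡⟨ cong (λ k → tailτ j ++ reverse (x k)) (+-comm h j) ⟩
      concatUpTo (suc h) (λ i → reverse (x (j + i)))
        ≡⟨ concatUpTo-suc h (λ i → reverse (x (j + i))) ⟩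
      reverse (x (j + 0)) ++ concatUpTo h (λ i → reverse (x (j + suc i)))
        ≡⟨ cong₂ _++_ (cong (λ k → reverse (x k)) (+-identityʳ j))
                      (concatUpTo-cong h (λ i → cong (λ k → reverse (x k)) (+-suc j i))) ⟩
      reverse (x j) ++ tailτ (suc j)  ∎

  Cτ-reverses : ∀ j → map (blockMirror ν (h + j)) (Cτ j) ≡ reverse (Cτ j)
  Cτ-reverses j =
    map-++-reverse f (concatUpTo h x) (concatUpTo j pairτ) (tailτ j) head↦tail pairs↦pairs tail↦head
    where
    open ≡-Reasoning
    f = blockMirror ν (h + j)
    f-x : ∀ b c → suc (b + c) ≡ h + j → map f (x b) ≡ x c
    f-x = map-blockMirror-block′ ν
    f-reverse-x : ∀ b c → suc (b + c) ≡ h + j → map f (reverse (x b)) ≡ reverse (x c)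
    f-reverse-x b c eq = trans (reverse-map f (x b)) (cong reverse (f-x b c eq))
    head↦tail : map f (concatUpTo h x) ≡ reverse (tailτ j)
    head↦tail = map-concatUpTo-reverse f h x (λ i → reverse (x (j + i))) λ i i′ eq →
      trans (f-x i (j + i′) (trans (regroup i i′ j) (cong (_+ j) eq))) (sym (reverse-involutive (x (j + i′))))
      where
      regroup : ∀ i i′ j → suc (i + (j + i′)) ≡ suc (i + i′) + j
      regroup = solve-∀
    tail↦head : map f (tailτ j) ≡ reverse (concatUpTo h x)
    tail↦head = map-concatUpTo-reverse f h (λ i → reverse (x (j + i))) x λ i i′ eq →
      f-reverse-x (j + i) i′ (trans (regroup i i′ j) (cong (_+ j) eq))
      where
      regroup : ∀ i i′ j → suc (j + i + i′) ≡ suc (i + i′) + j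
      regroup = solve-∀
    pairs↦pairs : map f (concatUpTo j pairτ) ≡ reverse (concatUpTo j pairτ)
    pairs↦pairs = map-concatUpTo-reverse f j pairτ pairτ λ i i′ eq → begin
      map f (x (h + i) ++ reverse (x i))             ≡⟨ map-++ f (x (h + i)) (reverse (x i)) ⟩
      map f (x (h + i)) ++ map f (reverse (x i))
        ≡⟨ cong₂ _++_ (f-x (h + i) i′ (trans (first-half h i i′) (cong (h +_) eq)))
                      (f-reverse-x i (h + i′) (trans (second-half h i i′) (cong (h +_) eq))) ⟩
      x i′ ++ reverse (x (h + i′))                   ≡⟨ cong (_++ reverse (x (h + i′))) (reverse-involutive (x i′)) ⟨
      reverse (reverse (x i′)) ++ reverse (x (h + i′)) ≡⟨ reverse-++ (x (h + i′)) (reverse (x i′)) ⟨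
      reverse (pairτ i′)                             ∎
      where
      first-half : ∀ h i i′ → suc (h + i + i′) ≡ h + suc (i + i′)
      first-half = solve-∀
      second-half : ∀ h i i′ → suc (i + (h + i′)) ≡ h + suc (i + i′)
      second-half = solve-∀

  Tτ-palindrome : ∀ j → IsPalindrome (tτ ν h (h * ν) j)
  Tτ-palindrome j = subst IsPalindrome (sym (tτ≡Cτ j))
    (IsDOWOn⇒IsDOW (Cτ-IsDOWOn j) ,
     involution-reverses⇒∼ (blockMirror ν (h + j)) (blockMirror-involutive ν (h + j)) (Cτ-reverses j))

proposition3p13 : (ν m j : ℕ) → ν ≥ 1 → j ≥ 1 →
    IsPalindrome (Tρ ν m j) ×
    ((h : ℕ) → m ≡ h * ν → IsPalindrome (tτ ν h m j))
proposition3p13 ν@(suc _) m j _ _ =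
  TangledCordRho.Tρ-palindrome ν m j ,
  λ h m≡hν → subst (λ m → IsPalindrome (tτ ν h m j)) (sym m≡hν) (TangledCordTau.Tτ-palindrome ν h j)
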